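{- For every $w\in\mathfrak{H}^0$, $$\overline{\Delta}(w)=s\circ(\widetilde\tau\otimes\widetilde\tau)\circ\Delta\circ\widetilde\tau(w),$$ where $s(a\otimes b)=b\otimes a$ is the flip.
   Context: Let $\mathfrak{H}=\mathbb{Q}\langle p,y\rangle$, $\mathfrak{H}^1=\mathbb{Q}\mathbf{1}\oplus\mathfrak{H}y$, $\mathfrak{H}^0=\mathbb{Q}\mathbf{1}\oplus p\mathfrak{H}y$, $z_k:=p^ky$ ($k\ge0$), so $\mathfrak{H}^1=\mathbb{Q}\langle z_k:k\ge0\rangle$. Let $\widetilde\tau$ be the anti-automorphism of $\mathfrak{H}$ with $\widetilde\tau(p)=y$, $\widetilde\tau(y)=p$. Let $\Delta\colon\mathfrak{H}^1\to\mathfrak{H}^1\otimes\mathfrak{H}^1$ be deconcatenation in the letters $z_k$: $\Delta(z_{k_1}\cdots z_{k_n})=\sum_{l=0}^{n}z_{k_1}\cdots z_{k_l}\otimes z_{k_{l+1}}\cdots z_{k_n}$ (empty products equal $\mathbf{1}$). Let $\mathcal{H}$ be the $\mathbb{Q}$-algebra spanned by words in the alphabet $\{p,d,y\}$ modulo $pd=dp=\mathbf{1}$ (concatenation product), which contains $\mathfrak{H}$. Let $\overline{\Delta}\colon\mathcal{H}\to\mathcal{H}\otimes\mathcal{H}$ be the linear map determined by $\overline{\Delta}(\mathbf{1})=\mathbf{1}\otimes\mathbf{1}$, $\overline{\Delta}(p)=p\otimes\mathbf{1}+\mathbf{1}\otimes p$, $\overline{\Delta}(y)=y\otimes\mathbf{1}$,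 $\overline{\Delta}(d)=0$ and $\overline{\Delta}(uv)=(u\otimes\mathbf{1})\overline{\Delta}(v)+\overline{\Delta}(u)(\mathbf{1}\otimes v)-u\otimes v$ for all $u,v\in\mathcal{H}$ (componentwise concatenation in $\mathcal{H}\otimes\mathcal{H}$). -}

module Defs where

open import Data.Nat using (ℕ; zero; suc)
open import Data.Rational using (ℚ; 0ℚ; 1ℚ; _+_; -_)
open import Data.List using (List; []; _∷_; _++_; map; reverse; concatMap; replicate)
open import Data.List.Properties using (≡-dec)
open import Data.Maybe using (Maybe; just; nothing)
open import Data.Product using (_×_; _,_)
open import Data.Empty using (⊥)
open import Data.Unit using (⊤)
open import Relation.Binary.PropositionalEquality using (_≡_; refl)
open import Relation.Nullary using (Dec; yes; no; ¬_)

data Letter : Set where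
  p y : Letter

_≟L_ : (a b : Letter) → Dec (a ≡ b)
p ≟L p = yes refl
p ≟L y = no λ ()
y ≟L p = no λ ()
y ≟L y = yes refl

Word : Set
Word = List Letter

_≟W_ : (u v : Word) → Dec (u ≡ v)
_≟W_ = ≡-dec _≟L_

-- Elements of 𝔥 : formal finite ℚ-linear combinations of words,
-- compared through their coefficient functions.

𝔥 : Set
𝔥 = List (ℚ × Word)

coeff : 𝔥 → Word → ℚ
coeff [] w = 0ℚ
coeff ((c , u) ∷ xs) w with u ≟W w
... | yes _ = c + coeff xs w
... | no  _ = coeff xs w

𝔥⊗𝔥 : Set
𝔥⊗𝔥 = List (ℚ × Word × Word)

coeff₂ : 𝔥⊗𝔥 → Word → Word → ℚ
coeff₂ [] a b = 0ℚ
coeff₂ ((c , u , v) ∷ xs) a b with u ≟W a | v ≟W b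
... | yes _ | yes _ = c + coeff₂ xs a b
... | _     | _     = coeff₂ xs a b

_≈⊗_ : 𝔥⊗𝔥 → 𝔥⊗𝔥 → Set
X ≈⊗ Y = ∀ a b → coeff₂ X a b ≡ coeff₂ Y a b

-- Subspaces 𝔥¹ = ℚ1 ⊕ 𝔥y and 𝔥⁰ = ℚ1 ⊕ p𝔥y

lastL : Word → Maybe Letter
lastL [] = nothing
lastL (a ∷ []) = just a
lastL (a ∷ b ∷ w) = lastL (b ∷ w)

Admissible : Word → Set
Admissible [] = ⊤
Admissible (y ∷ w) = ⊥
Admissible (p ∷ w) = lastL (p ∷ w) ≡ just y

In𝔥⁰ : 𝔥 → Set
In𝔥⁰ w = ∀ u → ¬ Admissible u → coeff w u ≡ 0ℚ

swapL : Letter → Letter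
swapL p = y
swapL y = p

τ̃W : Word → Word
τ̃W w = reverse (map swapL w)

τ̃ : 𝔥 → 𝔥
τ̃ = map (λ { (c , u) → c , τ̃W u })

-- Deconcatenation coproduct Δ on 𝔥¹ = ℚ⟨z_k : k ≥ 0⟩, z_k = p^k y

z : ℕ → Word
z k = replicate k p ++ (y ∷ [])

zWord : List ℕ → Word
zWord ks = concatMap z ks

-- factor a word of 𝔥¹ into letters z_k (nothing if it does not end in y)
-- auxiliary: k = number of p's read so far in the current block
toZ′ : ℕ → Word → Maybe (List ℕ)
toZ′ zero [] = just []
toZ′ (suc k) [] = nothing
toZ′ k (p ∷ w) = toZ′ (suc k) w
toZ′ k (y ∷ w) with toZ′ zero w
... | just ks = just (k ∷ ks)
... | nothing = nothing

toZ : Word → Maybe (List ℕ)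
toZ = toZ′ zero

deconc : List ℕ → List (List ℕ × List ℕ)
deconc [] = ([] , []) ∷ []
deconc (k ∷ ks) = ([] , k ∷ ks) ∷ map (λ { (a , b) → k ∷ a , b }) (deconc ks)

ΔW : Word → 𝔥⊗𝔥
ΔW w with toZ w
... | just ks = map (λ { (a , b) → 1ℚ , zWord a , zWord b }) (deconc ks)
... | nothing = []   -- not reached on 𝔥¹

Δ : 𝔥 → 𝔥⊗𝔥
Δ = concatMap (λ { (c , u) → map (λ { (d , a , b) → c Data.Rational.* d , a , b }) (ΔW u) })

τ̃⊗τ̃ : 𝔥⊗𝔥 → 𝔥⊗𝔥
τ̃⊗τ̃ = map (λ { (c , a , b) → c , τ̃W a , τ̃W b })

s : 𝔥⊗𝔥 → 𝔥⊗𝔥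
s = map (λ { (c , a , b) → c , b , a })

-- The map Δ̄ restricted to 𝔥 ⊂ 𝓗, computed letter by letter from
--   Δ̄(1) = 1⊗1, Δ̄(p) = p⊗1 + 1⊗p, Δ̄(y) = y⊗1,
--   Δ̄(a v) = (a⊗1) Δ̄(v) + Δ̄(a) (1⊗v) − a⊗v.

Δ̄L : Letter → 𝔥⊗𝔥
Δ̄L p = (1ℚ , p ∷ [] , []) ∷ (1ℚ , [] , p ∷ []) ∷ []
Δ̄L y = (1ℚ , y ∷ [] , []) ∷ []

Δ̄W : Word → 𝔥⊗𝔥
Δ̄W [] = (1ℚ , [] , []) ∷ []
Δ̄W (a ∷ v) =
  map (λ { (c , u , u′) → c , a ∷ u , u′ }) (Δ̄W v)
  ++ map (λ { (c , u , u′) → c , u , u′ ++ v }) (Δ̄L a)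
  ++ ((- 1ℚ) , a ∷ [] , v) ∷ []

Δ̄ : 𝔥 → 𝔥⊗𝔥
Δ̄ = concatMap (λ { (c , u) → map (λ { (d , a , b) → c Data.Rational.* d , a , b }) (Δ̄W u) })

{-# OPTIONS --safe #-}
-- Both sides are compared coefficientwise by pairing them with a test function φ on pairs of
-- words.  On a single word u, Δ̄(u) = u ⊗ 1 + Σ_{u = a·p·b} a ⊗ pb, while deconcatenating
-- t = τ̃(u) ∈ 𝔥¹ in the letters z_k gives Δ(t) = 1 ⊗ t + Σ_{t = a·y·b} ay ⊗ b.  Since
-- τ̃(a·y·b) = τ̃(b)·p·τ̃(a), the flip of τ̃ ⊗ τ̃ sends the second sum term by term onto the first,
-- and 1 ⊗ t onto u ⊗ 1.  The identity then extends linearly to 𝔥⁰, whose words all start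
-- with p (or are empty), so that their images under τ̃ lie in 𝔥¹.
module Submission where

open import Defs
open import Data.Nat using (ℕ; zero; suc; _≤_; z≤n; s≤s)
open import Data.Nat.Properties using (≤-refl; ≤-trans; m≤n⇒m≤1+n)
open import Data.Rational using (ℚ; 0ℚ; 1ℚ; _+_; _*_; -_)
open import Data.Rational.Properties
  using (+-identityˡ; +-identityʳ; +-assoc; +-comm; *-identityˡ; *-identityʳ; *-zeroˡ; *-zeroʳ)
open import Data.Rational.Solver using (module +-*-Solver)
open import Data.List using (List; []; _∷_; _++_; map; concatMap; replicate; reverse; length)
open import Data.List.Properties
  using (++-assoc; ++-identityʳ; map-++; map-∘; map-cong; map-id; reverse-++; unfold-reverse;
         reverse-map; reverse-involutive)
import Data.Maybe.Properties as Maybe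
open import Data.Maybe using (just)
open import Data.Product using (Σ; _×_; _,_)
open import Data.Sum using (_⊎_; inj₁; inj₂)
open import Data.Unit using (tt)
open import Function using (id; _∘_)
open import Relation.Binary.PropositionalEquality
open import Relation.Nullary using (Dec; yes; no; contradiction)
open ≡-Reasoning
open +-*-Solver using (solve; _:+_; _:*_; con; _:=_)

Test : Set
Test = Word → Word → ℚ

⟪_∣_⟫ : 𝔥⊗𝔥 → Test → ℚ
⟪ [] ∣ φ ⟫ = 0ℚ
⟪ (c , a , b) ∷ X ∣ φ ⟫ = c * φ a b + ⟪ X ∣ φ ⟫

indicator : Word → Word → Test
indicator a b u v with u ≟W a | v ≟W b
... | yes _ | yes _ = 1ℚ
... | _     | _     = 0ℚ

prefixed : Word → Test → Test
prefixed w φ a b = φ (w ++ a) b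

suffixed : Word → Test → Test
suffixed w φ a b = φ a (b ++ w)

zero-weight : ∀ c x → c * 0ℚ + x ≡ x
zero-weight c x = trans (cong (_+ x) (*-zeroʳ c)) (+-identityˡ x)

coeff₂≡pairing : ∀ X a b → coeff₂ X a b ≡ ⟪ X ∣ indicator a b ⟫
coeff₂≡pairing [] a b = refl
coeff₂≡pairing ((c , u , v) ∷ X) a b with u ≟W a | v ≟W b
... | yes _ | yes _ = trans (cong (c +_) (coeff₂≡pairing X a b)) (cong (_+ _) (sym (*-identityʳ c)))
... | yes _ | no _  = trans (coeff₂≡pairing X a b) (sym (zero-weight c _))
... | no _  | _     = trans (coeff₂≡pairing X a b) (sym (zero-weight c _))

pairing-++ : ∀ X Y φ → ⟪ X ++ Y ∣ φ ⟫ ≡ ⟪ X ∣ φ ⟫ + ⟪ Y ∣ φ ⟫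
pairing-++ [] Y φ = sym (+-identityˡ _)
pairing-++ ((c , a , b) ∷ X) Y φ =
  trans (cong (c * φ a b +_) (pairing-++ X Y φ)) (sym (+-assoc (c * φ a b) _ _))

pairing-map-scale : ∀ c (f : ℚ × Word × Word → ℚ × Word × Word) →
  (∀ d a b → f (d , a , b) ≡ (c * d , a , b)) → ∀ X φ → ⟪ map f X ∣ φ ⟫ ≡ c * ⟪ X ∣ φ ⟫
pairing-map-scale c f f-scales [] φ = sym (*-zeroʳ c)
pairing-map-scale c f f-scales ((d , a , b) ∷ X) φ rewrite f-scales d a b =
  trans (cong ((c * d) * φ a b +_) (pairing-map-scale c f f-scales X φ)) (distrib c d (φ a b) _)
  where
  distrib : ∀ c d x r → (c * d) * x + c * r ≡ c * (d * x + r)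
  distrib = solve 4 (λ c d x r → (c :* d) :* x :+ c :* r := c :* (d :* x :+ r)) refl

pairing-map-reindex : ∀ (g h : Word → Word → Word) (f : ℚ × Word × Word → ℚ × Word × Word) →
  (∀ d a b → f (d , a , b) ≡ (d , g a b , h a b)) →
  ∀ X φ → ⟪ map f X ∣ φ ⟫ ≡ ⟪ X ∣ (λ a b → φ (g a b) (h a b)) ⟫
pairing-map-reindex g h f f-reindexes [] φ = refl
pairing-map-reindex g h f f-reindexes ((d , a , b) ∷ X) φ rewrite f-reindexes d a b =
  cong (d * φ (g a b) (h a b) +_) (pairing-map-reindex g h f f-reindexes X φ)

cutsBeforeP : Word → Test → ℚ
cutsBeforeP [] φ = 0ℚ
cutsBeforeP (p ∷ v) φ = φ [] (p ∷ v) + cutsBeforeP v (prefixed (p ∷ []) φ)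
cutsBeforeP (y ∷ v) φ = cutsBeforeP v (prefixed (y ∷ []) φ)

pairing-prefix-Δ̄W : ∀ a v φ →
  ⟪ map (λ { (c , u , u′) → c , a ∷ u , u′ }) (Δ̄W v) ∣ φ ⟫ ≡ ⟪ Δ̄W v ∣ prefixed (a ∷ []) φ ⟫
pairing-prefix-Δ̄W a v φ = pairing-map-reindex (λ u _ → a ∷ u) (λ _ u′ → u′) _ (λ d u u′ → refl) (Δ̄W v) φ

pairing-Δ̄W-p∷ : ∀ v φ → ⟪ Δ̄W (p ∷ v) ∣ φ ⟫ ≡ ⟪ Δ̄W v ∣ prefixed (p ∷ []) φ ⟫ + φ [] (p ∷ v)
pairing-Δ̄W-p∷ v φ =
  trans (pairing-++ (map _ (Δ̄W v)) _ φ)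
        (cong₂ _+_ (pairing-prefix-Δ̄W p v φ) (cancel (φ (p ∷ []) v) (φ [] (p ∷ v))))
  where
  cancel : ∀ x r → 1ℚ * x + (1ℚ * r + ((- 1ℚ) * x + 0ℚ)) ≡ r
  cancel = solve 2 (λ x r → con 1ℚ :* x :+ (con 1ℚ :* r :+ (con (- 1ℚ) :* x :+ con 0ℚ)) := r) refl

pairing-Δ̄W-y∷ : ∀ v φ → ⟪ Δ̄W (y ∷ v) ∣ φ ⟫ ≡ ⟪ Δ̄W v ∣ prefixed (y ∷ []) φ ⟫
pairing-Δ̄W-y∷ v φ =
  trans (pairing-++ (map _ (Δ̄W v)) _ φ)
        (trans (cong₂ _+_ (pairing-prefix-Δ̄W y v φ) (cancel (φ (y ∷ []) v))) (+-identityʳ _))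
  where
  cancel : ∀ x → 1ℚ * x + ((- 1ℚ) * x + 0ℚ) ≡ 0ℚ
  cancel = solve 1 (λ x → con 1ℚ :* x :+ (con (- 1ℚ) :* x :+ con 0ℚ) := con 0ℚ) refl

pairing-Δ̄W : ∀ u φ → ⟪ Δ̄W u ∣ φ ⟫ ≡ φ u [] + cutsBeforeP u φ
pairing-Δ̄W [] φ = cong (_+ 0ℚ) (*-identityˡ (φ [] []))
pairing-Δ̄W (p ∷ v) φ = begin
  ⟪ Δ̄W (p ∷ v) ∣ φ ⟫                               ≡⟨ pairing-Δ̄W-p∷ v φ ⟩
  ⟪ Δ̄W v ∣ φ′ ⟫ + φ [] (p ∷ v)                     ≡⟨ cong (_+ φ [] (p ∷ v)) (pairing-Δ̄W v φ′) ⟩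
  (φ (p ∷ v) [] + cutsBeforeP v φ′) + φ [] (p ∷ v) ≡⟨ +-assoc (φ (p ∷ v) []) _ _ ⟩
  φ (p ∷ v) [] + (cutsBeforeP v φ′ + φ [] (p ∷ v)) ≡⟨ cong (φ (p ∷ v) [] +_) (+-comm (cutsBeforeP v φ′) _) ⟩
  φ (p ∷ v) [] + cutsBeforeP (p ∷ v) φ             ∎
  where
  φ′ : Test
  φ′ = prefixed (p ∷ []) φ
pairing-Δ̄W (y ∷ v) φ = trans (pairing-Δ̄W-y∷ v φ) (pairing-Δ̄W v (prefixed (y ∷ []) φ))

cutsAfterY : Word → Test → ℚ
cutsAfterY [] ψ = 0ℚ
cutsAfterY (p ∷ t) ψ = cutsAfterY t (prefixed (p ∷ []) ψ)
cutsAfterY (y ∷ t) ψ = ψ (y ∷ []) t + cutsAfterY t (prefixed (y ∷ []) ψ)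

cutsAfterY-cong : ∀ t {ψ χ} → (∀ a b → ψ a b ≡ χ a b) → cutsAfterY t ψ ≡ cutsAfterY t χ
cutsAfterY-cong [] ψ≗χ = refl
cutsAfterY-cong (p ∷ t) ψ≗χ = cutsAfterY-cong t (λ a b → ψ≗χ (p ∷ a) b)
cutsAfterY-cong (y ∷ t) ψ≗χ = cong₂ _+_ (ψ≗χ (y ∷ []) t) (cutsAfterY-cong t (λ a b → ψ≗χ (y ∷ a) b))

cutsAfterY-z++ : ∀ k t ψ → cutsAfterY (z k ++ t) ψ ≡ ψ (z k) t + cutsAfterY t (prefixed (z k) ψ)
cutsAfterY-z++ zero t ψ = refl
cutsAfterY-z++ (suc k) t ψ = cutsAfterY-z++ k t (prefixed (p ∷ []) ψ)

deconcSum : List (List ℕ × List ℕ) → Test → ℚ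
deconcSum [] ψ = 0ℚ
deconcSum ((a , b) ∷ P) ψ = ψ (zWord a) (zWord b) + deconcSum P ψ

deconcSum-deconc : ∀ ks ψ → deconcSum (deconc ks) ψ ≡ ψ [] (zWord ks) + cutsAfterY (zWord ks) ψ
deconcSum-deconc [] ψ = refl
deconcSum-deconc (k ∷ ks) ψ = cong (ψ [] (zWord (k ∷ ks)) +_) (begin
  deconcSum (map (λ { (a , b) → k ∷ a , b }) (deconc ks)) ψ
    ≡⟨ deconcSum-prefix (deconc ks) ⟩
  deconcSum (deconc ks) ψ′
    ≡⟨ deconcSum-deconc ks ψ′ ⟩
  ψ (z k ++ []) (zWord ks) + cutsAfterY (zWord ks) ψ′
    ≡⟨ cong (λ a → ψ a (zWord ks) + cutsAfterY (zWord ks) ψ′) (++-identityʳ (z k)) ⟩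
  ψ (z k) (zWord ks) + cutsAfterY (zWord ks) ψ′
    ≡⟨ cutsAfterY-z++ k (zWord ks) ψ ⟨
  cutsAfterY (zWord (k ∷ ks)) ψ
    ∎)
  where
  ψ′ : Test
  ψ′ = prefixed (z k) ψ
  deconcSum-prefix : ∀ P → deconcSum (map (λ { (a , b) → k ∷ a , b }) P) ψ ≡ deconcSum P ψ′
  deconcSum-prefix [] = refl
  deconcSum-prefix ((a , b) ∷ P) = cong (ψ (z k ++ zWord a) (zWord b) +_) (deconcSum-prefix P)

In𝔥¹ : Word → Set
In𝔥¹ t = Σ (List ℕ) λ ks → toZ t ≡ just ks

replicate-p-snoc : ∀ k t → replicate k p ++ p ∷ t ≡ replicate (suc k) p ++ t
replicate-p-snoc zero t = refl
replicate-p-snoc (suc k) t = cong (p ∷_) (replicate-p-snoc k t)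

toZ′-sound : ∀ k t {ks} → toZ′ k t ≡ just ks → replicate k p ++ t ≡ zWord ks
toZ′-sound zero [] refl = refl
toZ′-sound zero (p ∷ t) eq = toZ′-sound 1 t eq
toZ′-sound (suc k) (p ∷ t) eq = trans (replicate-p-snoc (suc k) t) (toZ′-sound (suc (suc k)) t eq)
toZ′-sound zero (y ∷ t) eq with toZ′ zero t in eq′
toZ′-sound zero (y ∷ t) refl | just ks = cong (y ∷_) (toZ′-sound zero t eq′)
toZ′-sound (suc k) (y ∷ t) eq with toZ′ zero t in eq′
toZ′-sound (suc k) (y ∷ t) refl | just ks =
  trans (cong (λ r → p ∷ replicate k p ++ y ∷ r) (toZ′-sound zero t eq′))
        (sym (++-assoc (replicate (suc k) p) (y ∷ []) (zWord ks)))

toZ′-complete : ∀ k t → lastL t ≡ just y → Σ (List ℕ) λ ks → toZ′ k t ≡ just ks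
toZ′-complete k (p ∷ []) ()
toZ′-complete zero (p ∷ b ∷ t) ends-y = toZ′-complete 1 (b ∷ t) ends-y
toZ′-complete (suc k) (p ∷ b ∷ t) ends-y = toZ′-complete (suc (suc k)) (b ∷ t) ends-y
toZ′-complete zero (y ∷ []) refl = 0 ∷ [] , refl
toZ′-complete (suc k) (y ∷ []) refl = suc k ∷ [] , refl
toZ′-complete zero (y ∷ b ∷ t) ends-y with toZ′-complete zero (b ∷ t) ends-y
... | ks , eq rewrite eq = 0 ∷ ks , refl
toZ′-complete (suc k) (y ∷ b ∷ t) ends-y with toZ′-complete zero (b ∷ t) ends-y
... | ks , eq rewrite eq = suc k ∷ ks , refl

pairing-ΔW : ∀ t → In𝔥¹ t → ∀ ψ → ⟪ ΔW t ∣ ψ ⟫ ≡ ψ [] t + cutsAfterY t ψ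
pairing-ΔW t (ks , eq) ψ with toZ′-sound zero t eq
... | t≡zWord with toZ t | eq
... | just _ | refl = begin
  ⟪ map (λ { (a , b) → 1ℚ , zWord a , zWord b }) (deconc ks) ∣ ψ ⟫
    ≡⟨ unit-weights (deconc ks) ⟩
  deconcSum (deconc ks) ψ
    ≡⟨ deconcSum-deconc ks ψ ⟩
  ψ [] (zWord ks) + cutsAfterY (zWord ks) ψ
    ≡⟨ cong (λ t′ → ψ [] t′ + cutsAfterY t′ ψ) t≡zWord ⟨
  ψ [] t + cutsAfterY t ψ
    ∎
  where
  unit-weights : ∀ P → ⟪ map (λ { (a , b) → 1ℚ , zWord a , zWord b }) P ∣ ψ ⟫ ≡ deconcSum P ψ
  unit-weights [] = refl
  unit-weights ((a , b) ∷ P) = cong₂ _+_ (*-identityˡ (ψ (zWord a) (zWord b))) (unit-weights P)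

swapL-involutive : ∀ a → swapL (swapL a) ≡ a
swapL-involutive p = refl
swapL-involutive y = refl

τ̃W-involutive : ∀ u → τ̃W (τ̃W u) ≡ u
τ̃W-involutive u = begin
  reverse (map swapL (reverse (map swapL u))) ≡⟨ cong reverse (reverse-map swapL (map swapL u)) ⟩
  reverse (reverse (map swapL (map swapL u))) ≡⟨ reverse-involutive _ ⟩
  map swapL (map swapL u)                     ≡⟨ map-∘ u ⟨
  map (swapL ∘ swapL) u                       ≡⟨ map-cong swapL-involutive u ⟩
  map id u                                    ≡⟨ map-id u ⟩
  u                                           ∎

τ̃W-∷ : ∀ a u → τ̃W (a ∷ u) ≡ τ̃W u ++ swapL a ∷ []
τ̃W-∷ a u = unfold-reverse (swapL a) (map swapL u)

τ̃W-∷ʳ : ∀ u a → τ̃W (u ++ a ∷ []) ≡ swapL a ∷ τ̃W u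
τ̃W-∷ʳ u a = trans (cong reverse (map-++ swapL u (a ∷ []))) (reverse-++ (map swapL u) (swapL a ∷ []))

τ̃W-τ̃W-∷ʳ : ∀ u a → τ̃W (τ̃W u ++ a ∷ []) ≡ swapL a ∷ u
τ̃W-τ̃W-∷ʳ u a = trans (τ̃W-∷ʳ (τ̃W u) a) (cong (swapL a ∷_) (τ̃W-involutive u))

-- the test function transported along s ∘ (τ̃ ⊗ τ̃)
τ̃-flip : Test → Test
τ̃-flip φ a b = φ (τ̃W b) (τ̃W a)

cutsAfterY-∷ʳp : ∀ t ψ → cutsAfterY (t ++ p ∷ []) ψ ≡ cutsAfterY t (suffixed (p ∷ []) ψ)
cutsAfterY-∷ʳp [] ψ = refl
cutsAfterY-∷ʳp (p ∷ t) ψ = cutsAfterY-∷ʳp t (prefixed (p ∷ []) ψ)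
cutsAfterY-∷ʳp (y ∷ t) ψ = cong (ψ (y ∷ []) (t ++ p ∷ []) +_) (cutsAfterY-∷ʳp t (prefixed (y ∷ []) ψ))

cutsAfterY-∷ʳy : ∀ t ψ →
  cutsAfterY (t ++ y ∷ []) ψ ≡ cutsAfterY t (suffixed (y ∷ []) ψ) + ψ (t ++ y ∷ []) []
cutsAfterY-∷ʳy [] ψ = trans (+-identityʳ (ψ (y ∷ []) [])) (sym (+-identityˡ (ψ (y ∷ []) [])))
cutsAfterY-∷ʳy (p ∷ t) ψ = cutsAfterY-∷ʳy t (prefixed (p ∷ []) ψ)
cutsAfterY-∷ʳy (y ∷ t) ψ =
  trans (cong (ψ (y ∷ []) (t ++ y ∷ []) +_) (cutsAfterY-∷ʳy t (prefixed (y ∷ []) ψ)))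
        (sym (+-assoc (ψ (y ∷ []) (t ++ y ∷ [])) _ _))

cutsAfterY-τ̃W : ∀ u φ → cutsAfterY (τ̃W u) (τ̃-flip φ) ≡ cutsBeforeP u φ
cutsAfterY-τ̃W [] φ = refl
cutsAfterY-τ̃W (p ∷ v) φ = begin
  cutsAfterY (τ̃W (p ∷ v)) (τ̃-flip φ)
    ≡⟨ cong (λ t → cutsAfterY t (τ̃-flip φ)) (τ̃W-∷ p v) ⟩
  cutsAfterY (τ̃W v ++ y ∷ []) (τ̃-flip φ)
    ≡⟨ cutsAfterY-∷ʳy (τ̃W v) (τ̃-flip φ) ⟩
  cutsAfterY (τ̃W v) (suffixed (y ∷ []) (τ̃-flip φ)) + φ [] (τ̃W (τ̃W v ++ y ∷ []))
    ≡⟨ cong₂ _+_ (cutsAfterY-cong (τ̃W v) (λ a b → cong (λ c → φ c (τ̃W a)) (τ̃W-∷ʳ b y)))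
                 (cong (φ []) (τ̃W-τ̃W-∷ʳ v y)) ⟩
  cutsAfterY (τ̃W v) (τ̃-flip (prefixed (p ∷ []) φ)) + φ [] (p ∷ v)
    ≡⟨ cong (_+ φ [] (p ∷ v)) (cutsAfterY-τ̃W v (prefixed (p ∷ []) φ)) ⟩
  cutsBeforeP v (prefixed (p ∷ []) φ) + φ [] (p ∷ v)
    ≡⟨ +-comm (cutsBeforeP v (prefixed (p ∷ []) φ)) _ ⟩
  cutsBeforeP (p ∷ v) φ
    ∎
cutsAfterY-τ̃W (y ∷ v) φ = begin
  cutsAfterY (τ̃W (y ∷ v)) (τ̃-flip φ)
    ≡⟨ cong (λ t → cutsAfterY t (τ̃-flip φ)) (τ̃W-∷ y v) ⟩
  cutsAfterY (τ̃W v ++ p ∷ []) (τ̃-flip φ)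
    ≡⟨ cutsAfterY-∷ʳp (τ̃W v) (τ̃-flip φ) ⟩
  cutsAfterY (τ̃W v) (suffixed (p ∷ []) (τ̃-flip φ))
    ≡⟨ cutsAfterY-cong (τ̃W v) (λ a b → cong (λ c → φ c (τ̃W a)) (τ̃W-∷ʳ b p)) ⟩
  cutsAfterY (τ̃W v) (τ̃-flip (prefixed (y ∷ []) φ))
    ≡⟨ cutsAfterY-τ̃W v (prefixed (y ∷ []) φ) ⟩
  cutsBeforeP (y ∷ v) φ
    ∎

pairing-ΔW-τ̃W : ∀ u → In𝔥¹ (τ̃W u) → ∀ φ → ⟪ ΔW (τ̃W u) ∣ τ̃-flip φ ⟫ ≡ ⟪ Δ̄W u ∣ φ ⟫
pairing-ΔW-τ̃W u τ̃u∈𝔥¹ φ = begin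
  ⟪ ΔW (τ̃W u) ∣ τ̃-flip φ ⟫
    ≡⟨ pairing-ΔW (τ̃W u) τ̃u∈𝔥¹ (τ̃-flip φ) ⟩
  φ (τ̃W (τ̃W u)) [] + cutsAfterY (τ̃W u) (τ̃-flip φ)
    ≡⟨ cong₂ _+_ (cong (λ a → φ a []) (τ̃W-involutive u)) (cutsAfterY-τ̃W u φ) ⟩
  φ u [] + cutsBeforeP u φ
    ≡⟨ pairing-Δ̄W u φ ⟨
  ⟪ Δ̄W u ∣ φ ⟫
    ∎

linear : (Word → ℚ) → 𝔥 → ℚ
linear g [] = 0ℚ
linear g ((c , u) ∷ w) = c * g u + linear g w

linear-τ̃ : ∀ g w → linear g (τ̃ w) ≡ linear (g ∘ τ̃W) w
linear-τ̃ g [] = refl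
linear-τ̃ g ((c , u) ∷ w) = cong (c * g (τ̃W u) +_) (linear-τ̃ g w)

pairing-concatMap : ∀ (F : Word → 𝔥⊗𝔥) (f : ℚ × Word → 𝔥⊗𝔥) φ →
  (∀ c u → ⟪ f (c , u) ∣ φ ⟫ ≡ c * ⟪ F u ∣ φ ⟫) →
  ∀ w → ⟪ concatMap f w ∣ φ ⟫ ≡ linear (λ u → ⟪ F u ∣ φ ⟫) w
pairing-concatMap F f φ f-scales-F [] = refl
pairing-concatMap F f φ f-scales-F ((c , u) ∷ w) =
  trans (pairing-++ (f (c , u)) _ φ) (cong₂ _+_ (f-scales-F c u) (pairing-concatMap F f φ f-scales-F w))

pairing-Δ̄ : ∀ w φ → ⟪ Δ̄ w ∣ φ ⟫ ≡ linear (λ u → ⟪ Δ̄W u ∣ φ ⟫) w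
pairing-Δ̄ w φ = pairing-concatMap Δ̄W _ φ (λ c u → pairing-map-scale c _ (λ d a b → refl) (Δ̄W u) φ) w

pairing-sτ̃Δτ̃ : ∀ w φ → ⟪ s (τ̃⊗τ̃ (Δ (τ̃ w))) ∣ φ ⟫ ≡ linear (λ u → ⟪ ΔW (τ̃W u) ∣ τ̃-flip φ ⟫) w
pairing-sτ̃Δτ̃ w φ = begin
  ⟪ s (τ̃⊗τ̃ (Δ (τ̃ w))) ∣ φ ⟫
    ≡⟨ pairing-map-reindex (λ _ b → b) (λ a _ → a) _ (λ d a b → refl) (τ̃⊗τ̃ (Δ (τ̃ w))) φ ⟩
  ⟪ τ̃⊗τ̃ (Δ (τ̃ w)) ∣ (λ a b → φ b a) ⟫
    ≡⟨ pairing-map-reindex (λ a _ → τ̃W a) (λ _ b → τ̃W b) _ (λ d a b → refl) (Δ (τ̃ w)) _ ⟩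
  ⟪ Δ (τ̃ w) ∣ τ̃-flip φ ⟫
    ≡⟨ pairing-concatMap ΔW _ _ (λ c u → pairing-map-scale c _ (λ d a b → refl) (ΔW u) _) (τ̃ w) ⟩
  linear (λ u → ⟪ ΔW u ∣ τ̃-flip φ ⟫) (τ̃ w)
    ≡⟨ linear-τ̃ _ w ⟩
  linear (λ u → ⟪ ΔW (τ̃W u) ∣ τ̃-flip φ ⟫) w
    ∎

deleteWord : Word → 𝔥 → 𝔥
deleteWord u [] = []
deleteWord u ((c , v) ∷ w) with v ≟W u
... | yes _ = deleteWord u w
... | no _  = (c , v) ∷ deleteWord u w

coeff-deleteWord-≡ : ∀ u w → coeff (deleteWord u w) u ≡ 0ℚ
coeff-deleteWord-≡ u [] = refl
coeff-deleteWord-≡ u ((c , v) ∷ w) with v ≟W u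
... | yes _ = coeff-deleteWord-≡ u w
... | no v≢u with v ≟W u
...   | yes v≡u = contradiction v≡u v≢u
...   | no _    = coeff-deleteWord-≡ u w

coeff-deleteWord-≢ : ∀ u w {v} → v ≢ u → coeff (deleteWord u w) v ≡ coeff w v
coeff-deleteWord-≢ u [] v≢u = refl
coeff-deleteWord-≢ u ((c , x) ∷ w) {v} v≢u with x ≟W u
... | yes refl with x ≟W v
...   | yes refl = contradiction refl v≢u
...   | no _     = coeff-deleteWord-≢ u w v≢u
coeff-deleteWord-≢ u ((c , x) ∷ w) {v} v≢u | no _ with x ≟W v
...   | yes _ = cong (c +_) (coeff-deleteWord-≢ u w v≢u)
...   | no _  = coeff-deleteWord-≢ u w v≢u

length-deleteWord : ∀ u w → length (deleteWord u w) ≤ length w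
length-deleteWord u [] = z≤n
length-deleteWord u ((c , v) ∷ w) with v ≟W u
... | yes _ = m≤n⇒m≤1+n (length-deleteWord u w)
... | no _  = s≤s (length-deleteWord u w)

length-deleteWord-head : ∀ c u w → length (deleteWord u ((c , u) ∷ w)) ≤ length w
length-deleteWord-head c u w with u ≟W u
... | yes _   = length-deleteWord u w
... | no u≢u = contradiction refl u≢u

linear-deleteWord : ∀ u g w → linear g w ≡ coeff w u * g u + linear g (deleteWord u w)
linear-deleteWord u g [] = sym (trans (cong (_+ 0ℚ) (*-zeroˡ (g u))) (+-identityʳ 0ℚ))
linear-deleteWord u g ((c , v) ∷ w) with v ≟W u
... | yes refl = trans (cong (c * g v +_) (linear-deleteWord v g w)) (collect c (g v) (coeff w v) _)
  where
  collect : ∀ c x d r → c * x + (d * x + r) ≡ (c + d) * x + r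
  collect = solve 4 (λ c x d r → c :* x :+ (d :* x :+ r) := (c :+ d) :* x :+ r) refl
... | no _ = trans (cong (c * g v +_) (linear-deleteWord u g w)) (exchange (c * g v) (coeff w u * g u) _)
  where
  exchange : ∀ a b r → a + (b + r) ≡ b + (a + r)
  exchange = solve 3 (λ a b r → a :+ (b :+ r) := b :+ (a :+ r)) refl

linear-cong-support : ∀ w {g h : Word → ℚ} → (∀ u → coeff w u ≡ 0ℚ ⊎ g u ≡ h u) → linear g w ≡ linear h w
linear-cong-support w = bounded (length w) w ≤-refl
  where
  weighted : ∀ c {x x′} → c ≡ 0ℚ ⊎ x ≡ x′ → c * x ≡ c * x′
  weighted c {x} {x′} (inj₁ refl) = trans (*-zeroˡ x) (sym (*-zeroˡ x′))
  weighted c (inj₂ refl) = refl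

  bounded : ∀ n w {g h} → length w ≤ n → (∀ u → coeff w u ≡ 0ℚ ⊎ g u ≡ h u) → linear g w ≡ linear h w
  bounded n [] _ _ = refl
  bounded (suc n) W@((c , u) ∷ w) {g} {h} (s≤s |w|≤n) agree = begin
    linear g W                                  ≡⟨ linear-deleteWord u g W ⟩
    coeff W u * g u + linear g (deleteWord u W) ≡⟨ cong₂ _+_ (weighted (coeff W u) (agree u)) rest ⟩
    coeff W u * h u + linear h (deleteWord u W) ≡⟨ linear-deleteWord u h W ⟨
    linear h W                                  ∎
    where
    agree′ : ∀ v → coeff (deleteWord u W) v ≡ 0ℚ ⊎ g v ≡ h v
    agree′ v with v ≟W u | agree v
    ... | yes refl | _          = inj₁ (coeff-deleteWord-≡ v W)
    ... | no v≢u   | inj₁ W[v]≡0 = inj₁ (trans (coeff-deleteWord-≢ u W v≢u) W[v]≡0)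
    ... | no _     | inj₂ gv≡hv  = inj₂ gv≡hv

    rest : linear g (deleteWord u W) ≡ linear h (deleteWord u W)
    rest = bounded n (deleteWord u W) (≤-trans (length-deleteWord-head c u w) |w|≤n) agree′

lastL-∷ʳ : ∀ u a → lastL (u ++ a ∷ []) ≡ just a
lastL-∷ʳ [] a = refl
lastL-∷ʳ (b ∷ []) a = refl
lastL-∷ʳ (b ∷ c ∷ u) a = lastL-∷ʳ (c ∷ u) a

τ̃W-p∷-In𝔥¹ : ∀ u → In𝔥¹ (τ̃W (p ∷ u))
τ̃W-p∷-In𝔥¹ u = toZ′-complete zero (τ̃W (p ∷ u)) (trans (cong lastL (τ̃W-∷ p u)) (lastL-∷ʳ (τ̃W u) y))

admissible⇒τ̃W-In𝔥¹ : ∀ u → Admissible u → In𝔥¹ (τ̃W u)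
admissible⇒τ̃W-In𝔥¹ [] _ = [] , refl
admissible⇒τ̃W-In𝔥¹ (p ∷ u) _ = τ̃W-p∷-In𝔥¹ u

admissible? : ∀ u → Dec (Admissible u)
admissible? [] = yes tt
admissible? (p ∷ u) = Maybe.≡-dec _≟L_ (lastL (p ∷ u)) (just y)
admissible? (y ∷ u) = no λ ()

theorem6p3 : (w : 𝔥) → In𝔥⁰ w → Δ̄ w ≈⊗ s (τ̃⊗τ̃ (Δ (τ̃ w)))
theorem6p3 w w∈𝔥⁰ a b = begin
  coeff₂ (Δ̄ w) a b                              ≡⟨ coeff₂≡pairing (Δ̄ w) a b ⟩
  ⟪ Δ̄ w ∣ φ ⟫                                    ≡⟨ pairing-Δ̄ w φ ⟩
  linear (λ u → ⟪ Δ̄W u ∣ φ ⟫) w                  ≡⟨ linear-cong-support w agree ⟩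
  linear (λ u → ⟪ ΔW (τ̃W u) ∣ τ̃-flip φ ⟫) w      ≡⟨ pairing-sτ̃Δτ̃ w φ ⟨
  ⟪ s (τ̃⊗τ̃ (Δ (τ̃ w))) ∣ φ ⟫                      ≡⟨ coeff₂≡pairing (s (τ̃⊗τ̃ (Δ (τ̃ w)))) a b ⟨
  coeff₂ (s (τ̃⊗τ̃ (Δ (τ̃ w)))) a b                ∎
  where
  φ : Test
  φ = indicator a b
  agree : ∀ u → coeff w u ≡ 0ℚ ⊎ ⟪ Δ̄W u ∣ φ ⟫ ≡ ⟪ ΔW (τ̃W u) ∣ τ̃-flip φ ⟫
  agree u with admissible? u
  ... | no ¬adm = inj₁ (w∈𝔥⁰ u ¬adm)
  ... | yes adm = inj₂ (sym (pairing-ΔW-τ̃W u (admissible⇒τ̃W-In𝔥¹ u adm) φ))
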